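{- Let $n\geq1$ and $d$ be integers, and let $\Delta$ be the Laplacian of $\mathrm{DB}(n,d)$ if $d\geq 0$, respectively of $\mathrm{Ktz}(n,|d|)$ if $d<0$. Then the Smith group satisfies $$\Gamma(\Delta)=\mathbb{Z}^n/\mathbb{Z}^n\Delta\cong(\mathbb{Z}[x]/(x^n-1))/\langle f_v\mid 0\le v\le n-1\rangle_{\mathbb{Z}}\cong\mathbb{Z}\oplus \mathcal Z_n/\langle f_v\mid 1\le v\le n-1\rangle_{\mathbb{Z}}.$$
   Context: $\mathrm{DB}(n,d)$: vertex set $\mathbb{Z}_n$, arcs $v\to dv+i$ ($0\le i\le d-1$); $\mathrm{Ktz}(n,d)$: vertex set $\mathbb{Z}_n$, arcs $v\to -d(v+1)+i$ ($0\le i\le d-1$); multiple arcs allowed. The Laplacian is $\Delta=D-A$ with $A_{v,w}$ the number of arcs $v\to w$ and $D$ the diagonal matrix of out-degrees; $\mathbb{Z}^n\Delta$ is the integer row space. In $\mathbb{Z}[x,x^{ -1}]/(x^n-1)$ (so $x^a$ depends only on $a\bmod n$), $f_v=d\,x^v-x^{dv}(x^d-1)/(x-1)$ for $0\le v\le n-1$, interpreted as $dx^v-\sum_{i=0}^{d-1}x^{dv+i}$ for $d\ge0$ and $dx^v+\sum_{i=0}^{|d|-1}x^{d(v+1)+i}$ for $d<0$. $\mathcal Z_n$ is the $\mathbb{Z}$-span of $x^v-1$, $1\le v\le n-1$. -}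

module Defs where

open import Data.Nat as ℕ using (ℕ; zero; suc; NonZero)
open import Data.Integer using (ℤ; +_; -[1+_]; _+_; _-_; _*_; -_; ∣_∣; _%ℕ_; 0ℤ; 1ℤ)
open import Data.Integer.Properties using (+-identityˡ; +-identityʳ)
open import Data.Integer.Tactic.RingSolver using (solve-∀)
open import Data.Fin using (Fin; toℕ) renaming (zero to fzero; suc to fsuc)
open import Data.Product using (Σ; ∃; _×_; _,_; proj₁; proj₂)
open import Relation.Nullary using (yes; no)
open import Relation.Binary.PropositionalEquality using (_≡_; refl; sym; trans; cong; cong₂)
open import Function.Bundles using (_⇔_)

Σℕ : ℕ → (ℕ → ℤ) → ℤ
Σℕ zero    g = 0ℤ
Σℕ (suc k) g = Σℕ k g + g k

ΣF : ∀ {n} → (Fin n → ℤ) → ℤ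
ΣF {zero}  g = 0ℤ
ΣF {suc n} g = g fzero + ΣF (λ v → g (fsuc v))

-- Vectors in ℤ^n, also used as coefficient vectors of elements of
-- ℤ[x]/(x^n - 1) (coefficient of x^w, w = 0..n-1).

Vecℤ : ℕ → Set
Vecℤ n = Fin n → ℤ

_⊖_ : ∀ {n} → Vecℤ n → Vecℤ n → Vecℤ n
(u ⊖ w) i = u i - w i

_⊕_ : ∀ {n} → Vecℤ n → Vecℤ n → Vecℤ n
(u ⊕ w) i = u i + w i

lin : ∀ {n m} → (Fin n → ℤ) → (Fin n → Vecℤ m) → Vecℤ m
lin c g w = ΣF (λ v → c v * g v w)

InSpan : ∀ {n m} → (Fin n → Vecℤ m) → Vecℤ m → Set
InSpan g u = Σ (Fin _ → ℤ) λ c → ∀ w → u w ≡ lin c g w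

InSpan⁺ : ∀ {n m} → (Fin n → Vecℤ m) → Vecℤ m → Set
InSpan⁺ g u = Σ (Fin _ → ℤ) λ c →
  (∀ v → toℕ v ≡ 0 → c v ≡ 0ℤ) × (∀ w → u w ≡ lin c g w)

-- The monomial x^a in ℤ[x]/(x^n - 1), a ∈ ℤ (depends only on a mod n)

mono : (n : ℕ) .{{_ : NonZero n}} → ℤ → Vecℤ n
mono n a w with a %ℕ n ℕ.≟ toℕ w
... | yes _ = 1ℤ
... | no  _ = 0ℤ

ι : ∀ {n} → Fin n → ℤ
ι v = + toℕ v

-- adjacency matrix of the digraph on ℤ_n with arcs v → t v i, 0 ≤ i ≤ k-1
adj : (n : ℕ) .{{_ : NonZero n}} → (k : ℕ) → (ℤ → ℕ → ℤ) → Fin n → Fin n → ℤ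
adj n k t v w = Σℕ k (λ i → mono n (t (ι v) i) w)

δ : ∀ {n} → Fin n → Fin n → ℤ
δ v w with toℕ v ℕ.≟ toℕ w
... | yes _ = 1ℤ
... | no  _ = 0ℤ

lapl : (n : ℕ) .{{_ : NonZero n}} → (k : ℕ) → (ℤ → ℕ → ℤ) → Fin n → Fin n → ℤ
lapl n k t v w = (+ k) * δ v w - adj n k t v w

DBarc : ℕ → ℤ → ℕ → ℤ
DBarc d v i = (+ d) * v + + i

Ktzarc : ℕ → ℤ → ℕ → ℤ
Ktzarc d v i = - ((+ d) * (v + 1ℤ)) + + i

LapDB : (n : ℕ) .{{_ : NonZero n}} → ℕ → Fin n → Fin n → ℤ
LapDB n d = lapl n d (DBarc d)

LapKtz : (n : ℕ) .{{_ : NonZero n}} → ℕ → Fin n → Fin n → ℤ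
LapKtz n d = lapl n d (Ktzarc d)

Lap : (n : ℕ) .{{_ : NonZero n}} → ℤ → Fin n → Fin n → ℤ
Lap n (+ d)      = LapDB n d
Lap n (-[1+ k ]) = LapKtz n (suc k)

fpoly : (n : ℕ) .{{_ : NonZero n}} → ℤ → Fin n → Vecℤ n
fpoly n (+ d) v w =
  (+ d) * mono n (ι v) w - Σℕ d (λ i → mono n ((+ d) * ι v + + i) w)
fpoly n d@(-[1+ k ]) v w =
  d * mono n (ι v) w + Σℕ (suc k) (λ i → mono n (d * (ι v + 1ℤ) + + i) w)

zgen : (n : ℕ) .{{_ : NonZero n}} → Fin n → Vecℤ n
zgen n v w = mono n (ι v) w - mono n 0ℤ w

InZ : (n : ℕ) .{{_ : NonZero n}} → Vecℤ n → Set
InZ n = InSpan⁺ (zgen n)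

swap+ : ∀ a b c e → (a + b) + (c + e) ≡ (a + c) + (b + e)
swap+ = solve-∀

swap- : ∀ a b c e → (a - b) + (c - e) ≡ (a + c) - (b + e)
swap- = solve-∀

dist- : ∀ a b x → (a - b) * x ≡ a * x - b * x
dist- = solve-∀

dist+ : ∀ a b x → (a + b) * x ≡ a * x + b * x
dist+ = solve-∀

ΣF-⊕ : ∀ {n} (f g : Fin n → ℤ) → ΣF (λ v → f v + g v) ≡ ΣF f + ΣF g
ΣF-⊕ {zero}  f g = refl
ΣF-⊕ {suc n} f g =
  trans (cong (λ t → (f fzero + g fzero) + t) (ΣF-⊕ (λ v → f (fsuc v)) (λ v → g (fsuc v))))
        (swap+ (f fzero) (g fzero) _ _)

ΣF-⊖ : ∀ {n} (f g : Fin n → ℤ) → ΣF (λ v → f v - g v) ≡ ΣF f - ΣF g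
ΣF-⊖ {zero}  f g = refl
ΣF-⊖ {suc n} f g =
  trans (cong (λ t → (f fzero - g fzero) + t) (ΣF-⊖ (λ v → f (fsuc v)) (λ v → g (fsuc v))))
        (swap- (f fzero) (g fzero) _ _)

ΣF-cong : ∀ {n} {f g : Fin n → ℤ} → (∀ v → f v ≡ g v) → ΣF f ≡ ΣF g
ΣF-cong {zero}  e = refl
ΣF-cong {suc n} e = cong₂ _+_ (e fzero) (ΣF-cong (λ v → e (fsuc v)))

span⁺-op : ∀ {n m} (g : Fin n → Vecℤ m) (_∙_ : ℤ → ℤ → ℤ)
  → (∀ a b → a ≡ 0ℤ → b ≡ 0ℤ → (a ∙ b) ≡ 0ℤ)
  → (∀ {k} (f h : Fin k → ℤ) → ΣF (λ v → f v ∙ h v) ≡ ΣF f ∙ ΣF h)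
  → (∀ a b x → (a ∙ b) * x ≡ (a * x) ∙ (b * x))
  → ∀ u u' → InSpan⁺ g u → InSpan⁺ g u' → InSpan⁺ g (λ w → u w ∙ u' w)
span⁺-op g _∙_ z Σop dist u u' (c , c0 , e) (c' , c0' , e') =
  (λ v → c v ∙ c' v) ,
  (λ v p → z _ _ (c0 v p) (c0' v p)) ,
  λ w → trans (cong₂ _∙_ (e w) (e' w))
         (trans (sym (Σop (λ v → c v * g v w) (λ v → c' v * g v w)))
                (ΣF-cong (λ v → sym (dist (c v) (c' v) (g v w)))))

InZ-⊖ : ∀ n .{{_ : NonZero n}} (u u' : Vecℤ n) → InZ n u → InZ n u' → InZ n (u ⊖ u')
InZ-⊖ n = span⁺-op (zgen n) _-_ (λ { a b refl refl → refl }) ΣF-⊖ dist-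

InZ-⊕ : ∀ n .{{_ : NonZero n}} (u u' : Vecℤ n) → InZ n u → InZ n u' → InZ n (u ⊕ u')
InZ-⊕ n = span⁺-op (zgen n) _+_ (λ { a b refl refl → refl }) ΣF-⊕ dist+

-- Abelian groups presented as (ambient group) / (subgroup), without
-- quotient types: a carrier with + and -, and a membership predicate
-- for the subgroup being factored out.  x ~ y  iff  x - y ∈ N.

record QGroup : Set₁ where
  field
    Carrier : Set
    _+ᴳ_    : Carrier → Carrier → Carrier
    _-ᴳ_    : Carrier → Carrier → Carrier
    N       : Carrier → Set

-- An isomorphism G/N ≅ H/M, given by a map on representatives which is a
-- homomorphism modulo M, induces a well-defined injective map
-- (a - a' ∈ N ⇔ φ a - φ a' ∈ M), and is surjective modulo M.
record QIso (G H : QGroup) : Set where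
  open QGroup G renaming (Carrier to A; _+ᴳ_ to _+A_; _-ᴳ_ to _-A_; N to NA)
  open QGroup H renaming (Carrier to B; _+ᴳ_ to _+B_; _-ᴳ_ to _-B_; N to NB)
  field
    φ      : A → B
    hom    : ∀ a a' → NB (φ (a +A a') -B (φ a +B φ a'))
    wd-inj : ∀ a a' → NA (a -A a') ⇔ NB (φ a -B φ a')
    surj   : ∀ b → Σ A λ a → NB (b -B φ a)

_≅_ : QGroup → QGroup → Set
G ≅ H = QIso G H

Smith : (n : ℕ) .{{_ : NonZero n}} → ℤ → QGroup
Smith n d = record
  { Carrier = Vecℤ n ; _+ᴳ_ = _⊕_ ; _-ᴳ_ = _⊖_
  ; N = λ u → Σ (Fin n → ℤ) λ c → ∀ w → u w ≡ ΣF (λ v → c v * Lap n d v w) }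

PolyQ : (n : ℕ) .{{_ : NonZero n}} → ℤ → QGroup
PolyQ n d = record
  { Carrier = Vecℤ n ; _+ᴳ_ = _⊕_ ; _-ᴳ_ = _⊖_
  ; N = InSpan (fpoly n d) }

ZQ : (n : ℕ) .{{_ : NonZero n}} → ℤ → QGroup
ZQ n d = record
  { Carrier = ℤ × Σ (Vecℤ n) (InZ n)
  ; _+ᴳ_ = λ { (a , u , p) (b , u' , p') → (a + b , u ⊕ u' , InZ-⊕ n u u' p p') }
  ; _-ᴳ_ = λ { (a , u , p) (b , u' , p') → (a - b , u ⊖ u' , InZ-⊖ n u u' p p') }
  ; N = λ { (a , u , _) → (a ≡ 0ℤ) × InSpan⁺ (fpoly n d) u } }

module Submission where

-- Identify ℤⁿ with ℤ[x]/(xⁿ-1) via coefficient vectors.  Row v of the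
-- Laplacian Δ = D - A is  k xᵛ - (sum of x^t over the arcs v → t),  so
-- Δ_v = ± f_v (the sign is that of d).  Hence ℤⁿΔ = ⟨f_v⟩ and the identity
-- map gives the first isomorphism.  For the second, a ↦ (Σ a, a - (Σ a)·1)
-- is an isomorphism onto ℤ ⊕ 𝒵ₙ/⟨f_v | v ≥ 1⟩ because
--   * every f_v has coefficient sum 0 (Δ has zero row sums, since every
--     vertex has out-degree k), so ⟨f_v⟩ lies in the sum-zero part, and
--   * Σ_v f_v = 0 (Δ has zero column sums, since every vertex also has
--     in-degree k), so f_0 is redundant among the generators.
-- In-regularity holds because the arc targets of DB(n,k), resp. Ktz(n,k),
-- run through the window [0, nk), resp. [-nk, 0), of consecutive
-- integers, and any n consecutive integers meet every residue mod n once.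
-- Finally 𝒵ₙ is exactly the set of coefficient vectors with sum 0.
-- The file develops, in order: finite sums; residues and monomials;
-- window sums; row/column sums of Laplacians; spans and 𝒵ₙ; the two
-- isomorphisms; the theorem.

open import Defs
open import Data.Nat as ℕ using (ℕ; zero; suc; NonZero)
open import Data.Integer using (ℤ; +_; -[1+_]; _+_; _-_; _*_; -_; _%ℕ_; _/ℕ_; 0ℤ; 1ℤ)
open import Data.Integer.Tactic.RingSolver using (solve-∀)
open import Data.Integer.DivMod using (n%ℕd<d; a≡a%ℕn+[a/ℕn]*n)
import Data.Integer.Properties as ℤP
import Data.Nat.Properties as ℕP
import Data.Fin.Properties as FinP
open import Data.Nat.DivMod using (m<n⇒m%n≡m)
open import Data.Fin using (Fin; toℕ; fromℕ<) renaming (zero to fzero; suc to fsuc)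
open import Data.Product using (Σ; _×_; _,_)
open import Data.Empty using (⊥-elim; ⊥-elim-irr)
open import Relation.Nullary using (yes; no)
open import Relation.Binary.PropositionalEquality
  using (_≡_; _≢_; refl; sym; trans; cong; cong₂; subst; module ≡-Reasoning)
open import Function.Bundles using (mk⇔)

open ≡-Reasoning

ΣF-zero : ∀ {n} (g : Fin n → ℤ) → (∀ v → g v ≡ 0ℤ) → ΣF g ≡ 0ℤ
ΣF-zero {zero}  g e = refl
ΣF-zero {suc n} g e = cong₂ _+_ (e fzero) (ΣF-zero _ (λ v → e (fsuc v)))

ΣF-single : ∀ {n} (g : Fin n → ℤ) (w : Fin n) → (∀ v → v ≢ w → g v ≡ 0ℤ) → ΣF g ≡ g w
ΣF-single {suc n} g fzero e =
  trans (cong (λ t → g fzero + t) (ΣF-zero _ (λ v → e (fsuc v) (λ ())))) (ℤP.+-identityʳ _)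
ΣF-single {suc n} g (fsuc w) e =
  trans (cong₂ _+_ (e fzero (λ ()))
          (ΣF-single (λ v → g (fsuc v)) w (λ v v≢w → e (fsuc v) (λ eq → v≢w (FinP.suc-injective eq)))))
        (ℤP.+-identityˡ _)

ΣF-scale : ∀ {n} c (g : Fin n → ℤ) → ΣF (λ v → c * g v) ≡ c * ΣF g
ΣF-scale {zero}  c g = sym (ℤP.*-zeroʳ c)
ΣF-scale {suc n} c g =
  trans (cong (λ t → c * g fzero + t) (ΣF-scale c (λ v → g (fsuc v)))) (sym (ℤP.*-distribˡ-+ c _ _))

ΣF-scaleʳ : ∀ {n} c (g : Fin n → ℤ) → ΣF (λ v → g v * c) ≡ ΣF g * c
ΣF-scaleʳ c g = trans (ΣF-cong (λ v → ℤP.*-comm (g v) c)) (trans (ΣF-scale c g) (ℤP.*-comm c _))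

ΣF-swap : ∀ {n m} (h : Fin n → Fin m → ℤ) →
  ΣF (λ v → ΣF (λ w → h v w)) ≡ ΣF (λ w → ΣF (λ v → h v w))
ΣF-swap {zero}  {m} h = sym (ΣF-zero {m} (λ _ → 0ℤ) (λ _ → refl))
ΣF-swap {suc n}     h =
  trans (cong (λ t → ΣF (h fzero) + t) (ΣF-swap (λ v → h (fsuc v))))
        (sym (ΣF-⊕ (h fzero) (λ w → ΣF (λ v → h (fsuc v) w))))

Σℕ-ΣF : ∀ {n} k (h : ℕ → Fin n → ℤ) →
  ΣF (λ w → Σℕ k (λ i → h i w)) ≡ Σℕ k (λ i → ΣF (h i))
Σℕ-ΣF {n} zero    h = ΣF-zero {n} (λ _ → 0ℤ) (λ _ → refl)
Σℕ-ΣF     (suc k) h = trans (ΣF-⊕ _ (h k)) (cong (_+ ΣF (h k)) (Σℕ-ΣF k h))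

Σℕ-cong : ∀ k {f g : ℕ → ℤ} → (∀ i → f i ≡ g i) → Σℕ k f ≡ Σℕ k g
Σℕ-cong zero    e = refl
Σℕ-cong (suc k) e = cong₂ _+_ (Σℕ-cong k e) (e k)

Σℕ-ones : ∀ k → Σℕ k (λ _ → 1ℤ) ≡ + k
Σℕ-ones zero    = refl
Σℕ-ones (suc k) = trans (cong (_+ 1ℤ) (Σℕ-ones k)) (cong +_ (ℕP.+-comm k 1))

Σℕ-head : ∀ k (g : ℕ → ℤ) → Σℕ (suc k) g ≡ g 0 + Σℕ k (λ i → g (suc i))
Σℕ-head zero    g = ℤP.+-comm 0ℤ (g 0)
Σℕ-head (suc k) g = trans (cong (_+ g (suc k)) (Σℕ-head k g)) (ℤP.+-assoc (g 0) _ _)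

ΣF-toℕ : ∀ {n} (G : ℕ → ℤ) → ΣF {n} (λ v → G (toℕ v)) ≡ Σℕ n G
ΣF-toℕ {zero}  G = refl
ΣF-toℕ {suc n} G = trans (cong (λ t → G 0 + t) (ΣF-toℕ {n} (λ j → G (suc j)))) (sym (Σℕ-head n G))

remainder-unique : ∀ {n r r'} s → r ℕ.< n → r' ℕ.< n → + r ≡ + r' + s * + n → r ≡ r'
remainder-unique {n} {r} {r'} (+ zero) r<n r'<n e =
  trans (ℤP.+-injective (trans e (cong (λ t → + r' + t) (ℤP.*-zeroˡ (+ n))))) (ℕP.+-identityʳ r')
remainder-unique {n} {r} {r'} (+ suc k) r<n r'<n e = ⊥-elim (ℕP.<⇒≱ r<n n≤r)
  where
  r≡ : r ≡ r' ℕ.+ suc k ℕ.* n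
  r≡ = ℤP.+-injective (trans e (cong (λ t → + r' + t) (sym (ℤP.pos-* (suc k) n))))
  n≤r : n ℕ.≤ r
  n≤r = subst (n ℕ.≤_) (sym r≡) (ℕP.≤-trans (ℕP.m≤m+n n (k ℕ.* n)) (ℕP.m≤n+m _ r'))
remainder-unique {n} {r} {r'} -[1+ k ] r<n r'<n e =
  sym (remainder-unique (+ suc k) r'<n r<n
        (trans (flip (+ r') -[1+ k ] (+ n)) (cong (_+ + suc k * + n) (sym e))))
  where
  flip : ∀ b s m → b ≡ (b + s * m) + (- s) * m
  flip = solve-∀

%ℕ-periodic : ∀ n .{{_ : NonZero n}} a → (a + + n) %ℕ n ≡ a %ℕ n
%ℕ-periodic n a = remainder-unique ((q + 1ℤ) - q') (n%ℕd<d (a + + n) n) (n%ℕd<d a n) r'≡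
  where
  r = + (a %ℕ n); q = a /ℕ n; r' = + ((a + + n) %ℕ n); q' = (a + + n) /ℕ n
  rearrange : ∀ r' q' r q m → r' ≡ (r + ((q + 1ℤ) - q') * m) + ((r' + q' * m) - ((r + q * m) + m))
  rearrange = solve-∀
  both-are-a+n : (r' + q' * + n) - ((r + q * + n) + + n) ≡ 0ℤ
  both-are-a+n = trans (cong₂ _-_ (sym (a≡a%ℕn+[a/ℕn]*n (a + + n) n))
                                  (cong (_+ + n) (sym (a≡a%ℕn+[a/ℕn]*n a n))))
                       (ℤP.+-inverseʳ (a + + n))
  r'≡ : r' ≡ r + ((q + 1ℤ) - q') * + n
  r'≡ = trans (rearrange r' q' r q (+ n))
              (trans (cong (λ t → (r + ((q + 1ℤ) - q') * + n) + t) both-are-a+n) (ℤP.+-identityʳ _))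

mono-one : ∀ n .{{_ : NonZero n}} a w → a %ℕ n ≡ toℕ w → mono n a w ≡ 1ℤ
mono-one n a w e with a %ℕ n ℕ.≟ toℕ w
... | yes _ = refl
... | no ne = ⊥-elim (ne e)

mono-zero : ∀ n .{{_ : NonZero n}} a w → a %ℕ n ≢ toℕ w → mono n a w ≡ 0ℤ
mono-zero n a w ne with a %ℕ n ℕ.≟ toℕ w
... | yes e = ⊥-elim (ne e)
... | no _  = refl

mono-cong : ∀ n .{{_ : NonZero n}} a b w → a %ℕ n ≡ b %ℕ n → mono n a w ≡ mono n b w
mono-cong n a b w e with b %ℕ n ℕ.≟ toℕ w
... | yes e' = mono-one n a w (trans e e')
... | no ne  = mono-zero n a w (λ e' → ne (trans (sym e) e'))

ι%ℕ : ∀ n .{{_ : NonZero n}} (v : Fin n) → ι v %ℕ n ≡ toℕ v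
ι%ℕ n v = m<n⇒m%n≡m (FinP.toℕ<n v)

mono-ι-self : ∀ n .{{_ : NonZero n}} (w : Fin n) → mono n (ι w) w ≡ 1ℤ
mono-ι-self n w = mono-one n (ι w) w (ι%ℕ n w)

mono-ι-other : ∀ n .{{_ : NonZero n}} (v w : Fin n) → v ≢ w → mono n (ι v) w ≡ 0ℤ
mono-ι-other n v w v≢w =
  mono-zero n (ι v) w (λ e → v≢w (FinP.toℕ-injective (trans (sym (ι%ℕ n v)) e)))

δ-mono : ∀ n .{{_ : NonZero n}} (v w : Fin n) → δ v w ≡ mono n (ι v) w
δ-mono n v w with toℕ v ℕ.≟ toℕ w
... | no ne = sym (mono-ι-other n v w (λ e → ne (cong toℕ e)))
... | yes e with FinP.toℕ-injective e
...   | refl = sym (mono-ι-self n v)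

mono-sum : ∀ n .{{_ : NonZero n}} a → ΣF (mono n a) ≡ 1ℤ
mono-sum n a =
  trans (ΣF-single (mono n a) r
           (λ v v≢r → mono-zero n a v (λ e → v≢r (FinP.toℕ-injective (trans (sym e) (sym toℕ-r))))))
        (mono-one n a r (sym toℕ-r))
  where
  r = fromℕ< (n%ℕd<d a n)
  toℕ-r = FinP.toℕ-fromℕ< (n%ℕd<d a n)

mono-column-sum : ∀ n .{{_ : NonZero n}} (w : Fin n) → ΣF {n} (λ v → mono n (ι v) w) ≡ 1ℤ
mono-column-sum n w =
  trans (ΣF-single {n} (λ v → mono n (ι v) w) w (λ v v≢w → mono-ι-other n v w v≢w)) (mono-ι-self n w)

-- Sums over windows of consecutive exponents.

window : (ℤ → ℤ) → ℤ → ℕ → ℤ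
window h a L = Σℕ L (λ j → h (a + + j))

window-concat : ∀ h a L K → window h a L + window h (a + + L) K ≡ window h a (L ℕ.+ K)
window-concat h a L zero = trans (ℤP.+-identityʳ _) (cong (window h a) (sym (ℕP.+-identityʳ L)))
window-concat h a L (suc K) = begin
    window h a L + (window h (a + + L) K + h ((a + + L) + + K))
  ≡⟨ sym (ℤP.+-assoc (window h a L) _ _) ⟩
    (window h a L + window h (a + + L) K) + h ((a + + L) + + K)
  ≡⟨ cong₂ _+_ (window-concat h a L K) (cong h (ℤP.+-assoc a (+ L) (+ K))) ⟩
    window h a (L ℕ.+ K) + h (a + + (L ℕ.+ K))
  ≡⟨ cong (window h a) (sym (ℕP.+-suc L K)) ⟩
    window h a (L ℕ.+ suc K) ∎

-- For h of period p, sliding a window of length p by one step does not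
-- change its sum: the term dropped at a equals the term gained at a + p.
window-slide : ∀ h p → (∀ a → h (a + + p) ≡ h a) → ∀ a → window h (a + 1ℤ) p ≡ window h a p
window-slide h p periodic a = begin
    window h (a + 1ℤ) p
  ≡⟨ cancelˡ (window h a 1) _ ⟩
    (window h a 1 + window h (a + + 1) p) - window h a 1
  ≡⟨ cong₂ _-_ (trans (window-concat h a 1 p) (cong (window h a) (ℕP.+-comm 1 p))) first≡last ⟩
    window h a (p ℕ.+ 1) - window h (a + + p) 1
  ≡⟨ cong (_- window h (a + + p) 1) (sym (window-concat h a p 1)) ⟩
    (window h a p + window h (a + + p) 1) - window h (a + + p) 1
  ≡⟨ sym (cancelʳ (window h a p) _) ⟩
    window h a p ∎
  where
  single : ∀ b → window h b 1 ≡ h b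
  single b = trans (ℤP.+-identityˡ _) (cong h (ℤP.+-identityʳ b))
  first≡last : window h a 1 ≡ window h (a + + p) 1
  first≡last = trans (single a) (trans (sym (periodic a)) (sym (single (a + + p))))
  cancelˡ : ∀ x y → y ≡ (x + y) - x
  cancelˡ = solve-∀
  cancelʳ : ∀ x y → x ≡ (x + y) - y
  cancelʳ = solve-∀

slide-invariant : {A : Set} (F : ℤ → A) → (∀ a → F (a + 1ℤ) ≡ F a) → ∀ a → F a ≡ F 0ℤ
slide-invariant F inv (+ zero)          = refl
slide-invariant F inv (+ suc k)         =
  trans (cong F (cong +_ (ℕP.+-comm 1 k))) (trans (inv (+ k)) (slide-invariant F inv (+ k)))
slide-invariant F inv -[1+ zero ]       = sym (inv -[1+ zero ])
slide-invariant F inv -[1+ suc k ]      = trans (sym (inv -[1+ suc k ])) (slide-invariant F inv -[1+ k ])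

module MonomialWindows (n : ℕ) .{{_ : NonZero n}} (w : Fin n) where

  coeff : ℤ → ℤ
  coeff a = mono n a w

  window-n : ∀ a → window coeff a n ≡ 1ℤ
  window-n a = trans (slide-invariant (λ b → window coeff b n)
                       (window-slide coeff n periodic) a) window-0
    where
    periodic : ∀ b → coeff (b + + n) ≡ coeff b
    periodic b = mono-cong n (b + + n) b w (%ℕ-periodic n b)
    window-0 : window coeff 0ℤ n ≡ 1ℤ
    window-0 = trans (sym (ΣF-toℕ {n} (λ j → mono n (+ j) w))) (mono-column-sum n w)

  window-mn : ∀ m a → window coeff a (m ℕ.* n) ≡ + m
  window-mn zero    a = refl
  window-mn (suc m) a =
    trans (sym (window-concat coeff a n (m ℕ.* n))) (cong₂ _+_ (window-n a) (window-mn m (a + + n)))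

windows-ascending : ∀ h k m → Σℕ m (λ j → window h (+ k * + j) k) ≡ window h 0ℤ (m ℕ.* k)
windows-ascending h k zero    = refl
windows-ascending h k (suc m) =
  trans (cong₂ _+_ (windows-ascending h k m)
                   (cong (λ t → window h t k) (trans (sym (ℤP.pos-* k m)) (cong +_ (ℕP.*-comm k m)))))
        (trans (window-concat h 0ℤ (m ℕ.* k) k) (cong (window h 0ℤ) (ℕP.+-comm (m ℕ.* k) k)))

windows-descending : ∀ h k m →
  Σℕ m (λ j → window h (- (+ k * (+ j + 1ℤ))) k) ≡ window h (- (+ k * + m)) (m ℕ.* k)
windows-descending h k zero    = refl
windows-descending h k (suc m) = begin
    Σℕ m (λ j → window h (- (+ k * (+ j + 1ℤ))) k) + window h b k
  ≡⟨ cong (_+ window h b k) (windows-descending h k m) ⟩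
    window h (- (+ k * + m)) (m ℕ.* k) + window h b k
  ≡⟨ ℤP.+-comm _ (window h b k) ⟩
    window h b k + window h (- (+ k * + m)) (m ℕ.* k)
  ≡⟨ cong (λ t → window h b k + window h t (m ℕ.* k)) (sym (step (+ k) (+ m))) ⟩
    window h b k + window h (b + + k) (m ℕ.* k)
  ≡⟨ window-concat h b k (m ℕ.* k) ⟩
    window h b (suc m ℕ.* k)
  ≡⟨ cong (λ t → window h (- (+ k * t)) (suc m ℕ.* k)) (cong +_ (ℕP.+-comm m 1)) ⟩
    window h (- (+ k * + suc m)) (suc m ℕ.* k) ∎
  where
  b = - (+ k * (+ m + 1ℤ))
  step : ∀ k m → - (k * (m + 1ℤ)) + k ≡ - (k * m)
  step = solve-∀

-- Row and column sums of Laplacians of regular digraphs.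

-- k·(a sum equal to 1) minus (a sum equal to k) vanishes: this is why the
-- row (column) sums of D - A vanish when out- (in-)degrees are all k.
degree-cancel : ∀ {n} k (e a : Fin n → ℤ) → ΣF e ≡ 1ℤ → ΣF a ≡ + k →
  ΣF (λ v → + k * e v - a v) ≡ 0ℤ
degree-cancel k e a Σe Σa = begin
    ΣF (λ v → + k * e v - a v)
  ≡⟨ ΣF-⊖ (λ v → + k * e v) a ⟩
    ΣF (λ v → + k * e v) - ΣF a
  ≡⟨ cong₂ _-_ (trans (ΣF-scale (+ k) e) (cong (+ k *_) Σe)) Σa ⟩
    + k * 1ℤ - + k
  ≡⟨ vanish (+ k) ⟩
    0ℤ ∎
  where
  vanish : ∀ x → x * 1ℤ - x ≡ 0ℤ
  vanish = solve-∀

-- every vertex of a k-out-regular digraph has k outgoing arcs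
lapl-row-sum : ∀ n .{{_ : NonZero n}} k t (v : Fin n) → ΣF (lapl n k t v) ≡ 0ℤ
lapl-row-sum n k t v = degree-cancel k (δ v) (adj n k t v)
  (trans (ΣF-cong (δ-mono n v)) (mono-sum n (ι v)))
  (trans (Σℕ-ΣF k (λ i → mono n (t (ι v) i)))
         (trans (Σℕ-cong k (λ i → mono-sum n (t (ι v) i))) (Σℕ-ones k)))

InRegular : (n : ℕ) .{{_ : NonZero n}} → ℕ → (ℤ → ℕ → ℤ) → Set
InRegular n k t = ∀ w → ΣF (λ v → adj n k t v w) ≡ + k

lapl-column-sum : ∀ n .{{_ : NonZero n}} k t → InRegular n k t →
  ∀ (w : Fin n) → ΣF (λ v → lapl n k t v w) ≡ 0ℤ
lapl-column-sum n k t in-reg w = degree-cancel k (λ v → δ v w) (λ v → adj n k t v w)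
  (trans (ΣF-cong (λ v → δ-mono n v w)) (mono-column-sum n w)) (in-reg w)

DB-in-regular : ∀ n .{{_ : NonZero n}} k → InRegular n k (DBarc k)
DB-in-regular n k w = begin
    ΣF {n} (λ v → window coeff (+ k * ι v) k)
  ≡⟨ ΣF-toℕ {n} (λ j → window coeff (+ k * + j) k) ⟩
    Σℕ n (λ j → window coeff (+ k * + j) k)
  ≡⟨ windows-ascending coeff k n ⟩
    window coeff 0ℤ (n ℕ.* k)
  ≡⟨ cong (window coeff 0ℤ) (ℕP.*-comm n k) ⟩
    window coeff 0ℤ (k ℕ.* n)
  ≡⟨ window-mn k 0ℤ ⟩
    + k ∎
  where open MonomialWindows n w

Ktz-in-regular : ∀ n .{{_ : NonZero n}} k → InRegular n k (Ktzarc k)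
Ktz-in-regular n k w = begin
    ΣF {n} (λ v → window coeff (- (+ k * (ι v + 1ℤ))) k)
  ≡⟨ ΣF-toℕ {n} (λ j → window coeff (- (+ k * (+ j + 1ℤ))) k) ⟩
    Σℕ n (λ j → window coeff (- (+ k * (+ j + 1ℤ))) k)
  ≡⟨ windows-descending coeff k n ⟩
    window coeff (- (+ k * + n)) (n ℕ.* k)
  ≡⟨ cong (window coeff (- (+ k * + n))) (ℕP.*-comm n k) ⟩
    window coeff (- (+ k * + n)) (k ℕ.* n)
  ≡⟨ window-mn k (- (+ k * + n)) ⟩
    + k ∎
  where open MonomialWindows n w

Lap-column-sum : ∀ n .{{_ : NonZero n}} d (w : Fin n) → ΣF (λ v → Lap n d v w) ≡ 0ℤ
Lap-column-sum n (+ k)      = lapl-column-sum n k (DBarc k) (DB-in-regular n k)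
Lap-column-sum n -[1+ k' ]  = lapl-column-sum n (suc k') (Ktzarc (suc k')) (Ktz-in-regular n (suc k'))

Lap-row-sum : ∀ n .{{_ : NonZero n}} d (v : Fin n) → ΣF (Lap n d v) ≡ 0ℤ
Lap-row-sum n (+ k)     = lapl-row-sum n k (DBarc k)
Lap-row-sum n -[1+ k' ] = lapl-row-sum n (suc k') (Ktzarc (suc k'))

-- The rows of Δ are ± f_v.

sgn : ℤ → ℤ
sgn (+ _)    = 1ℤ
sgn -[1+ _ ] = - 1ℤ

sgn-involutive : ∀ d x → sgn d * (sgn d * x) ≡ x
sgn-involutive (+ _)    x = trans (ℤP.*-identityˡ _) (ℤP.*-identityˡ x)
sgn-involutive -[1+ _ ] x = neg-neg x
  where
  neg-neg : ∀ x → (- 1ℤ) * ((- 1ℤ) * x) ≡ x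
  neg-neg = solve-∀

Lap≡sgn*fpoly : ∀ n .{{_ : NonZero n}} d v w → Lap n d v w ≡ sgn d * fpoly n d v w
Lap≡sgn*fpoly n (+ k) v w =
  trans (cong (λ t → + k * t - Σℕ k (λ i → mono n (+ k * ι v + + i) w)) (δ-mono n v w))
        (sym (ℤP.*-identityˡ _))
Lap≡sgn*fpoly n -[1+ k' ] v w =
  trans (cong₂ (λ t s → + k * t - s) (δ-mono n v w)
           (Σℕ-cong k (λ i → cong (λ t → mono n (t + + i) w) (ℤP.neg-distribˡ-* (+ k) (ι v + 1ℤ)))))
        (negate (+ k) (mono n (ι v) w) (Σℕ k (λ i → mono n (-[1+ k' ] * (ι v + 1ℤ) + + i) w)))
  where
  k = suc k'
  negate : ∀ k M X → k * M - X ≡ (- 1ℤ) * ((- k) * M + X)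
  negate = solve-∀

fpoly≡sgn*Lap : ∀ n .{{_ : NonZero n}} d v w → fpoly n d v w ≡ sgn d * Lap n d v w
fpoly≡sgn*Lap n d v w =
  trans (sym (sgn-involutive d (fpoly n d v w))) (cong (sgn d *_) (sym (Lap≡sgn*fpoly n d v w)))

fpoly-row-sum : ∀ n .{{_ : NonZero n}} d (v : Fin n) → ΣF (fpoly n d v) ≡ 0ℤ
fpoly-row-sum n d v =
  trans (ΣF-cong (fpoly≡sgn*Lap n d v))
        (trans (ΣF-scale (sgn d) (Lap n d v)) (trans (cong (sgn d *_) (Lap-row-sum n d v)) (ℤP.*-zeroʳ (sgn d))))

fpoly-column-sum : ∀ n .{{_ : NonZero n}} d (w : Fin n) → ΣF (λ v → fpoly n d v w) ≡ 0ℤ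
fpoly-column-sum n d w =
  trans (ΣF-cong (λ v → fpoly≡sgn*Lap n d v w))
        (trans (ΣF-scale (sgn d) (λ v → Lap n d v w))
               (trans (cong (sgn d *_) (Lap-column-sum n d w)) (ℤP.*-zeroʳ (sgn d))))

span-rescale : ∀ {n m} (g g' : Fin n → Vecℤ m) s → (∀ v w → g v w ≡ s * g' v w) →
  ∀ u → InSpan g u → InSpan g' u
span-rescale g g' s g≡ u (c , e) = (λ v → c v * s) ,
  λ w → trans (e w) (ΣF-cong (λ v → trans (cong (c v *_) (g≡ v w)) (sym (ℤP.*-assoc (c v) s (g' v w)))))

span-zero : ∀ {n m} (g : Fin n → Vecℤ m) u → (∀ w → u w ≡ 0ℤ) → InSpan g u
span-zero {n} g u e = (λ _ → 0ℤ) , λ w → trans (e w) (sym (ΣF-zero {n} _ (λ _ → refl)))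

span⁺-zero : ∀ {n m} (g : Fin n → Vecℤ m) u → (∀ w → u w ≡ 0ℤ) → InSpan⁺ g u
span⁺-zero {n} g u e =
  (λ _ → 0ℤ) , (λ _ _ → refl) , λ w → trans (e w) (sym (ΣF-zero {n} _ (λ _ → refl)))

span-sum-zero : ∀ {n m} (g : Fin n → Vecℤ m) → (∀ v → ΣF (g v) ≡ 0ℤ) →
  ∀ u → InSpan g u → ΣF u ≡ 0ℤ
span-sum-zero {n} {m} g row0 u (c , e) =
  trans (ΣF-cong e)
   (trans (sym (ΣF-swap {n} {m} (λ v w → c v * g v w)))
          (ΣF-zero {n} _ (λ v → trans (ΣF-scale (c v) (g v))
                                       (trans (cong (c v *_) (row0 v)) (ℤP.*-zeroʳ (c v))))))

-- If the generators sum to 0, the first one is redundant: subtracting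
-- c₀ from every coefficient does not change Σ c_v g_v.
span⇒span⁺ : ∀ {n m} (g : Fin (suc n) → Vecℤ m) → (∀ w → ΣF (λ v → g v w) ≡ 0ℤ) →
  ∀ u → InSpan g u → InSpan⁺ g u
span⇒span⁺ g col0 u (c , e) = c' , c'₀ , λ w → trans (e w) (same w)
  where
  c' : Fin _ → ℤ
  c' v = c v - c fzero
  c'₀ : ∀ v → toℕ v ≡ 0 → c' v ≡ 0ℤ
  c'₀ fzero _ = ℤP.+-inverseʳ (c fzero)
  same : ∀ w → lin c g w ≡ lin c' g w
  same w = sym (begin
      ΣF (λ v → (c v - c fzero) * g v w)
    ≡⟨ ΣF-cong (λ v → dist- (c v) (c fzero) (g v w)) ⟩
      ΣF (λ v → c v * g v w - c fzero * g v w)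
    ≡⟨ ΣF-⊖ (λ v → c v * g v w) (λ v → c fzero * g v w) ⟩
      lin c g w - ΣF (λ v → c fzero * g v w)
    ≡⟨ cong (λ t → lin c g w - t) (trans (ΣF-scale (c fzero) (λ v → g v w))
                                 (trans (cong (c fzero *_) (col0 w)) (ℤP.*-zeroʳ (c fzero)))) ⟩
      lin c g w - 0ℤ
    ≡⟨ ℤP.+-identityʳ _ ⟩
      lin c g w ∎)

span-ext : ∀ {n m} (g : Fin n → Vecℤ m) {u u'} → InSpan g u → (∀ w → u' w ≡ u w) → InSpan g u'
span-ext g (c , e) u'≡u = c , λ w → trans (u'≡u w) (e w)

span⁺⇒span : ∀ {n m} (g : Fin n → Vecℤ m) u → InSpan⁺ g u → InSpan g u
span⁺⇒span g u (c , _ , e) = c , e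

-- 𝒵ₙ is the set of vectors with coefficient sum 0.

zgen-combination : ∀ n .{{_ : NonZero n}} c (w : Fin n) →
  lin c (zgen n) w ≡ c w - ΣF c * mono n 0ℤ w
zgen-combination n c w = begin
    ΣF (λ v → c v * (mono n (ι v) w - mono n 0ℤ w))
  ≡⟨ ΣF-cong (λ v → distrib (c v) (mono n (ι v) w) (mono n 0ℤ w)) ⟩
    ΣF (λ v → c v * mono n (ι v) w - c v * mono n 0ℤ w)
  ≡⟨ ΣF-⊖ (λ v → c v * mono n (ι v) w) (λ v → c v * mono n 0ℤ w) ⟩
    ΣF (λ v → c v * mono n (ι v) w) - ΣF (λ v → c v * mono n 0ℤ w)
  ≡⟨ cong₂ _-_ coordinate (ΣF-scaleʳ (mono n 0ℤ w) c) ⟩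
    c w - ΣF c * mono n 0ℤ w ∎
  where
  distrib : ∀ a x y → a * (x - y) ≡ a * x - a * y
  distrib = solve-∀
  coordinate : ΣF (λ v → c v * mono n (ι v) w) ≡ c w
  coordinate = trans (ΣF-single (λ v → c v * mono n (ι v) w) w
                        (λ v v≢w → trans (cong (c v *_) (mono-ι-other n v w v≢w)) (ℤP.*-zeroʳ (c v))))
                     (trans (cong (c w *_) (mono-ι-self n w)) (ℤP.*-identityʳ (c w)))

InZ⇒sum-zero : ∀ n .{{_ : NonZero n}} u → InZ n u → ΣF u ≡ 0ℤ
InZ⇒sum-zero n u p = span-sum-zero (zgen n)
  (λ v → trans (ΣF-⊖ (mono n (ι v)) (mono n 0ℤ))
               (trans (cong₂ _-_ (mono-sum n (ι v)) (mono-sum n 0ℤ)) (ℤP.+-inverseʳ 1ℤ)))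
  u (span⁺⇒span (zgen n) u p)

-- Take c = u with c₀ replaced by 0; the v = 0 generator x⁰ - 1 is zero anyway.
sum-zero⇒InZ : ∀ n u → ΣF {suc n} u ≡ 0ℤ → InZ (suc n) u
sum-zero⇒InZ n u Σu≡0 = c , c₀ , u≡
  where
  c : Fin (suc n) → ℤ
  c fzero    = 0ℤ
  c (fsuc v) = u (fsuc v)
  c₀ : ∀ v → toℕ v ≡ 0 → c v ≡ 0ℤ
  c₀ fzero _ = refl
  zgen₀ : ∀ w → zgen (suc n) fzero w ≡ 0ℤ
  zgen₀ w = ℤP.+-inverseʳ (mono (suc n) 0ℤ w)
  u≡ : ∀ w → u w ≡ lin c (zgen (suc n)) w
  u≡ w = begin
      u w
    ≡⟨ sym (ℤP.+-identityʳ (u w)) ⟩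
      u w - 0ℤ * mono (suc n) 0ℤ w
    ≡⟨ cong (λ t → u w - t * mono (suc n) 0ℤ w) (sym Σu≡0) ⟩
      u w - ΣF u * mono (suc n) 0ℤ w
    ≡⟨ sym (zgen-combination (suc n) u w) ⟩
      u fzero * zgen (suc n) fzero w + rest
    ≡⟨ cong (_+ rest) (trans (cong (u fzero *_) (zgen₀ w)) (ℤP.*-zeroʳ (u fzero))) ⟩
      0ℤ * zgen (suc n) fzero w + rest ∎
    where
    rest = ΣF (λ v → u (fsuc v) * zgen (suc n) (fsuc v) w)

-- Γ(Δ) ≅ (ℤ[x]/(xⁿ-1))/⟨f_v⟩: the identity, since Δ_v = ± f_v.
smith≅poly : ∀ n .{{_ : NonZero n}} d → Smith n d ≅ PolyQ n d
smith≅poly n d = record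
  { φ      = λ a → a
  ; hom    = λ a a' → span-zero (fpoly n d) _ (λ w → ℤP.+-inverseʳ (a w + a' w))
  ; wd-inj = λ a a' → mk⇔ (span-rescale (Lap n d) (fpoly n d) (sgn d) (Lap≡sgn*fpoly n d) (a ⊖ a'))
                          (span-rescale (fpoly n d) (Lap n d) (sgn d) (fpoly≡sgn*Lap n d) (a ⊖ a'))
  ; surj   = λ b → b , span-zero (fpoly n d) _ (λ w → ℤP.+-inverseʳ (b w))
  }

-- The NonZero instance is a parameter so that the type of poly≅Z mentions
-- the caller's instance literally; otherwise checking it against the
-- theorem would unfold ZQ completely.
module PolyToZ (n : ℕ) .{{i : NonZero (suc n)}} (d : ℤ) where

  N : ℕ
  N = suc n

  f : Fin N → Vecℤ N
  f = fpoly N d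

  one : Vecℤ N
  one = mono N 0ℤ

  reduce : Vecℤ N → Vecℤ N
  reduce a w = a w - ΣF a * one w

  reduce∈Z : ∀ a → InZ N (reduce a)
  reduce∈Z a = sum-zero⇒InZ n (reduce a) (begin
      ΣF (λ w → a w - ΣF a * one w)
    ≡⟨ ΣF-⊖ a (λ w → ΣF a * one w) ⟩
      ΣF a - ΣF (λ w → ΣF a * one w)
    ≡⟨ cong (λ t → ΣF a - t) (trans (ΣF-scale (ΣF a) one) (cong (ΣF a *_) (mono-sum N 0ℤ))) ⟩
      ΣF a - ΣF a * 1ℤ
    ≡⟨ vanish (ΣF a) ⟩
      0ℤ ∎)
    where
    vanish : ∀ x → x - x * 1ℤ ≡ 0ℤ
    vanish = solve-∀

  φ : Vecℤ N → ℤ × Σ (Vecℤ N) (InZ N)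
  φ a = ΣF a , reduce a , reduce∈Z a

  reduce-diff : ∀ a a' → ΣF a - ΣF a' ≡ 0ℤ → ∀ w → reduce a w - reduce a' w ≡ a w - a' w
  reduce-diff a a' Σ≡ w =
    trans (regroup (a w) (a' w) (ΣF a) (ΣF a') (one w))
          (trans (cong (λ t → (a w - a' w) - t * one w) Σ≡) (drop (a w - a' w) (one w)))
    where
    regroup : ∀ x y s s' e → (x - s * e) - (y - s' * e) ≡ (x - y) - (s - s') * e
    regroup = solve-∀
    drop : ∀ x e → x - 0ℤ * e ≡ x
    drop = solve-∀

  φ-hom : ∀ a a' → (ΣF (a ⊕ a') - (ΣF a + ΣF a') ≡ 0ℤ) ×
                    InSpan⁺ f (λ w → reduce (a ⊕ a') w - (reduce a w + reduce a' w))
  φ-hom a a' = trans (cong (_- (ΣF a + ΣF a')) (ΣF-⊕ a a')) (ℤP.+-inverseʳ (ΣF a + ΣF a')) ,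
    span⁺-zero f _ (λ w → trans (cong (λ t → ((a w + a' w) - t * one w) - (reduce a w + reduce a' w))
                                      (ΣF-⊕ a a'))
                                (additive (a w) (a' w) (ΣF a) (ΣF a') (one w)))
    where
    additive : ∀ x y s t e → ((x + y) - (s + t) * e) - ((x - s * e) + (y - t * e)) ≡ 0ℤ
    additive = solve-∀

  -- a ~ a' ⇒ φ a ~ φ a': uses that the f_v have zero row and column sums
  φ-injective : ∀ a a' → InSpan f (a ⊖ a') →
    (ΣF a - ΣF a' ≡ 0ℤ) × InSpan⁺ f (λ w → reduce a w - reduce a' w)
  φ-injective a a' p =
    Σ≡ , span⇒span⁺ f (fpoly-column-sum N d) _ (span-ext f p (reduce-diff a a' Σ≡))
    where
    Σ≡ : ΣF a - ΣF a' ≡ 0ℤ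
    Σ≡ = trans (sym (ΣF-⊖ a a')) (span-sum-zero f (fpoly-row-sum N d) (a ⊖ a') p)

  φ-reflects : ∀ a a' → (ΣF a - ΣF a' ≡ 0ℤ) × InSpan⁺ f (λ w → reduce a w - reduce a' w) →
    InSpan f (a ⊖ a')
  φ-reflects a a' (Σ≡ , p) =
    span-ext f (span⁺⇒span f _ p) (λ w → sym (reduce-diff a a' Σ≡ w))

  φ-surjective : ∀ b u (p : InZ N u) →
    Σ (Vecℤ N) λ a → (b - ΣF a ≡ 0ℤ) × InSpan⁺ f (λ w → u w - reduce a w)
  φ-surjective b u p = a , trans (cong (λ t → b - t) Σa≡b) (ℤP.+-inverseʳ b) ,
    span⁺-zero f _ (λ w → trans (cong (λ t → u w - ((u w + b * one w) - t * one w)) Σa≡b)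
                                (cancel (u w) b (one w)))
    where
    a : Vecℤ N
    a w = u w + b * one w
    cancel : ∀ u b e → u - ((u + b * e) - b * e) ≡ 0ℤ
    cancel = solve-∀
    Σa≡b : ΣF a ≡ b
    Σa≡b = trans (ΣF-⊕ u (λ w → b * one w))
             (trans (cong₂ _+_ (InZ⇒sum-zero N u p) (trans (ΣF-scale b one) (cong (b *_) (mono-sum N 0ℤ))))
                    (trans (ℤP.+-identityˡ (b * 1ℤ)) (ℤP.*-identityʳ b)))

  poly≅Z : PolyQ N {{i}} d ≅ ZQ N {{i}} d
  poly≅Z = record
    { φ      = φ
    ; hom    = φ-hom
    ; wd-inj = λ a a' → mk⇔ (φ-injective a a') (φ-reflects a a')
    ; surj   = λ { (b , u , p) → φ-surjective b u p }
    }

lemma2p2 : (n : ℕ) .{{_ : NonZero n}} (d : ℤ) →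
    (Smith n d ≅ PolyQ n d) × (PolyQ n d ≅ ZQ n d)
lemma2p2 zero    ⦃ n≢0 ⦄ d = ⊥-elim-irr (ℕ.NonZero.nonZero n≢0)
lemma2p2 (suc n) ⦃ i ⦄ d = smith≅poly (suc n) d , PolyToZ.poly≅Z n ⦃ i ⦄ d
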